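{- Let $G$ be a graph, $k,\ell\ge1$, $S$ an independent set of size $k$, and $J_0=S,J_1,\dots,J_\ell$ independent sets of $G$. Define $\mathcal{C}_0=\{\{(S,k)\}\}$ and, for $i\in\{1,\dots,\ell\}$, let $\mathcal{C}_i$ contain, for every $C\in\mathcal{C}_{i-1}$ and every $(X,b)\in C$, the constraint set consisting of $(N(X)\cap J_i,1)$, of $(X\cap J_i,b-1)$ if $b\ge2$ (nothing if $b=1$), and of $(X'\cap J_i,b')$ for every other $(X',b')\in C$. Then for every $i\in\{0,\dots,\ell\}$ and every independent set $Z\subseteq J_i$ with $|Z|=k$: if there is a sequence $S=I'_0,I'_1,\dots,I'_i=Z$ in which each $I'_{p+1}$ is obtained from $I'_p$ by a token slide and $I'_p\subseteq J_p$ for every $p\in\{0,\dots,i\}$, then $Z$ satisfies at least one constraint set in $\mathcal{C}_i$.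
   Context: A constraint is a pair $(X,b)$ with $X\subseteq V(G)$ and $b$ a positive integer; $Z$ satisfies $(X,b)$ if $|Z\cap X|=b$, and satisfies a constraint set if it satisfies all its constraints. $N(X)$ is the set of vertices outside $X$ adjacent to some vertex of $X$. A token slide transforms an independent set $I$ into $I'=(I\setminus\{u\})\cup\{v\}$ with $u\in I$, $v\notin I$, $\{u,v\}\in E(G)$, and $I'$ independent. -}

module Defs where

open import Data.Nat using (ℕ; zero; suc; _≤_; _<_; _∸_; _≡ᵇ_)
open import Data.Bool using (Bool; true; false; _∧_; _∨_; not; if_then_else_; T)
open import Data.Fin using (Fin; zero; suc)
open import Data.Fin.Subset using (Subset; _∈_; _∉_; _⊆_; _∩_; _∪_; _-_; ⁅_⁆; ∣_∣)
open import Data.Vec using (lookup; tabulate)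
open import Data.List using (List; []; _∷_; map; concatMap; _++_)
open import Data.List.Relation.Unary.All using (All)
open import Data.Product using (_×_; _,_)
open import Relation.Binary.PropositionalEquality using (_≡_)

record Graph (n : ℕ) : Set where
  field
    adj     : Fin n → Fin n → Bool
    symm    : ∀ u v → adj u v ≡ adj v u
    irrefl  : ∀ u → adj u u ≡ false
open Graph public

anyFin : ∀ {n} → (Fin n → Bool) → Bool
anyFin {zero}  p = false
anyFin {suc n} p = p zero ∨ anyFin (λ i → p (suc i))

module _ {n : ℕ} (G : Graph n) where

  Independent : Subset n → Set
  Independent I = ∀ u v → u ∈ I → v ∈ I → adj G u v ≡ false

  Nbh : Subset n → Subset n
  Nbh X = tabulate (λ v → not (lookup X v) ∧ anyFin (λ u → lookup X u ∧ adj G u v))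

  TokenSlide : Subset n → Subset n → Set
  TokenSlide I I' = Data.Product.Σ (Fin n) λ u → Data.Product.Σ (Fin n) λ v →
    u ∈ I × v ∉ I × adj G u v ≡ true × I' ≡ ((I - u) ∪ ⁅ v ⁆) × Independent I'

Constraint : ℕ → Set
Constraint n = Subset n × ℕ

ConstraintSet : ℕ → Set
ConstraintSet n = List (Constraint n)

SatC : ∀ {n} → Subset n → Constraint n → Set
SatC Z (X , b) = ∣ Z ∩ X ∣ ≡ b

Satisfies : ∀ {n} → Subset n → ConstraintSet n → Set
Satisfies Z C = All (SatC Z) C

select : ∀ {A : Set} → List A → List (A × List A)
select []       = []
select (x ∷ xs) = (x , xs) ∷ map (λ { (y , ys) → (y , x ∷ ys) }) (select xs)

module _ {n : ℕ} (G : Graph n) where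

  step : Subset n → Constraint n → ConstraintSet n → ConstraintSet n
  step J (X , b) rest =
    (Nbh G X ∩ J , 1) ∷
    ((if b ≡ᵇ 1 then [] else ((X ∩ J , b ∸ 1) ∷ [])) ++
     map (λ { (X' , b') → (X' ∩ J , b') }) rest)

  𝒞 : Subset n → ℕ → (ℕ → Subset n) → ℕ → List (ConstraintSet n)
  𝒞 S k J zero    = ((S , k) ∷ []) ∷ []
  𝒞 S k J (suc i) =
    concatMap (λ C → map (λ { (c , rest) → step (J (suc i)) c rest }) (select C))
              (𝒞 S k J i)

-- Along the slide sequence we maintain a constraint set C of 𝒞_i that is
-- "admissible" for I'_i: all its sets lie in J_i, I'_i satisfies it, and every
-- token of I'_i lies in exactly one of its sets.  When the token on u slides to v,
-- let (X , b) be the constraint whose set contains u.  As J_i is independent and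
-- contains u, the vertex v lies outside J_i, hence outside every set of C, and in
-- N(X); conversely N(X) misses J_i ⊇ I'_i.  So after restricting to J_{i+1}, v is
-- the only token in N(X), X keeps b − 1 tokens, every other set keeps its tokens,
-- and the constraint set of 𝒞_{i+1} obtained by choosing (X , b) is admissible.
module Submission where

open import Defs
open import Data.Bool using (Bool; true; false; _∧_; not; if_then_else_; T)
open import Data.Bool.Properties using (∧-conicalˡ; ∧-conicalʳ)
open import Data.Empty using (⊥-elim)
open import Data.Fin using (Fin; zero; suc)
open import Data.Fin.Subset using (Subset; inside; outside; _∈_; _∉_; _⊆_; _∩_; _∪_; _-_; ⁅_⁆; ∣_∣)
open import Data.Fin.Subset.Properties
  using ( _∈?_; ⊆-antisym; p─⊥≡p; p─q⊆p; p∩q⊆q; x∈p∩q⁺; x∈p∩q⁻; x∈p∪q⁺; x∈p∪q⁻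
        ; x∈⁅x⁆; x∈⁅y⁆⇒x≡y; ∣⁅x⁆∣≡1; x∈p∧x≢y⇒x∈p-y; ∩-idem )
open import Data.List using (List; []; _∷_; map; _++_)
open import Data.List.Properties using (map-++)
open import Data.List.Relation.Unary.All as All using (All; []; _∷_)
import Data.List.Relation.Unary.All.Properties as All
open import Data.List.Relation.Unary.Any as Any using (Any)
import Data.List.Relation.Unary.Any.Properties as Any
open import Data.List.Relation.Binary.Permutation.Propositional using (_↭_; ↭-refl; ↭-sym; ↭-trans; ↭-prep; ↭-swap)
open import Data.List.Relation.Binary.Permutation.Propositional.Properties using (All-resp-↭)
import Data.List.Relation.Binary.Permutation.Propositional.Properties as ↭
open import Data.Nat using (ℕ; zero; suc; _+_; _∸_; _≤_; _<_; _≡ᵇ_)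
open import Data.Nat.ListAction using (sum)
open import Data.Nat.ListAction.Properties using (sum-++; sum-↭)
open import Data.Nat.Properties
  using (≡ᵇ⇒≡; suc-injective; +-identityʳ; m+n≡0⇒m≡0; m+n≡0⇒n≡0; ≤-refl; ≤-trans; <⇒≤; n≤1+n; m≤n⇒m≤1+n; m<n⇒m<1+n)
open import Data.Product using (_×_; _,_; proj₁; proj₂; ∃)
open import Data.Sum using (_⊎_; inj₁; inj₂)
open import Data.Vec using (lookup; _∷_; here; there)
open import Data.Vec.Properties using ([]=⇒lookup; lookup⇒[]=; lookup∘tabulate)
open import Data.Unit using (tt)
open import Function using (_∘_)
open import Relation.Nullary using (¬_; yes; no; does; contradiction)
open import Relation.Binary.PropositionalEquality

private
  variable
    n : ℕ

x∈p⇒∣p∣≡1+∣p-x∣ : ∀ {x : Fin n} {p : Subset n} → x ∈ p → ∣ p ∣ ≡ suc ∣ p - x ∣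
x∈p⇒∣p∣≡1+∣p-x∣ {x = zero}  {inside ∷ p}  here        = cong suc (cong ∣_∣ (sym (p─⊥≡p p)))
x∈p⇒∣p∣≡1+∣p-x∣ {x = suc x} {inside ∷ p}  (there x∈p) = cong suc (x∈p⇒∣p∣≡1+∣p-x∣ x∈p)
x∈p⇒∣p∣≡1+∣p-x∣ {x = suc x} {outside ∷ p} (there x∈p) = x∈p⇒∣p∣≡1+∣p-x∣ x∈p

∣p∣≡0⇒x∉p : ∀ {x : Fin n} {p : Subset n} → ∣ p ∣ ≡ 0 → x ∉ p
∣p∣≡0⇒x∉p ∣p∣≡0 x∈p with () ← trans (sym (x∈p⇒∣p∣≡1+∣p-x∣ x∈p)) ∣p∣≡0

x∈p-y⇒x≢y : ∀ {x y : Fin n} (p : Subset n) → x ∈ p - y → x ≢ y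
x∈p-y⇒x≢y {x = zero}  {zero}  (_ ∷ p) ()            refl
x∈p-y⇒x≢y {x = suc x} {suc y} (_ ∷ p) (there x∈p-y) refl = x∈p-y⇒x≢y p x∈p-y refl

x∉p⇒p-x≡p : ∀ {x : Fin n} {p : Subset n} → x ∉ p → p - x ≡ p
x∉p⇒p-x≡p {x = x} {p} x∉p =
  ⊆-antisym (p─q⊆p p ⁅ x ⁆) (λ y∈p → x∈p∧x≢y⇒x∈p-y y∈p λ { refl → x∉p y∈p })

x∉p⇒p[x]≡outside : ∀ {x : Fin n} (p : Subset n) → x ∉ p → lookup p x ≡ outside
x∉p⇒p[x]≡outside {x = x} p x∉p with lookup p x in p[x]
... | inside  = ⊥-elim (x∉p (lookup⇒[]= x p p[x]))
... | outside = refl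

anyFin⁺ : (f : Fin n → Bool) (i : Fin n) → f i ≡ true → anyFin f ≡ true
anyFin⁺ f zero    fi rewrite fi = refl
anyFin⁺ f (suc i) fi with f zero
... | true  = refl
... | false = anyFin⁺ (λ j → f (suc j)) i fi

anyFin⁻ : (f : Fin n → Bool) → anyFin f ≡ true → ∃ λ i → f i ≡ true
anyFin⁻ {suc n} f any with f zero in f0
... | true  = zero , f0
... | false with anyFin⁻ (λ j → f (suc j)) any
...   | i , fi = suc i , fi

module _ (G : Graph n) where

  ∈Nbh⁺ : ∀ {X u v} → u ∈ X → v ∉ X → adj G u v ≡ true → v ∈ Nbh G X
  ∈Nbh⁺ {X} {u} {v} u∈X v∉X uv = lookup⇒[]= v (Nbh G X) (trans (lookup∘tabulate _ v)
    (cong₂ _∧_ (cong not (x∉p⇒p[x]≡outside X v∉X))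
               (anyFin⁺ _ u (cong₂ _∧_ ([]=⇒lookup u∈X) uv))))

  ∈Nbh⁻ : ∀ {X v} → v ∈ Nbh G X → ∃ λ u → u ∈ X × adj G u v ≡ true
  ∈Nbh⁻ {X} {v} v∈N with anyFin⁻ _ (∧-conicalʳ _ _ (trans (sym (lookup∘tabulate _ v)) ([]=⇒lookup v∈N)))
  ... | u , uv = u , lookup⇒[]= u X (∧-conicalˡ _ _ uv) , ∧-conicalʳ _ _ uv

  Nbh-disjoint : ∀ {J X v} → Independent G J → X ⊆ J → v ∈ J → v ∉ Nbh G X
  Nbh-disjoint J-indep X⊆J v∈J v∈N with ∈Nbh⁻ v∈N
  ... | u , u∈X , uv with () ← trans (sym uv) (J-indep u _ (X⊆J u∈X) v∈J)

indicator : Fin n → Subset n → ℕ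
indicator w X = if does (w ∈? X) then 1 else 0

restrict : Subset n → Constraint n → Constraint n
restrict J (X , b) = X ∩ J , b

occurrences : Fin n → ConstraintSet n → ℕ
occurrences w C = sum (map (λ c → indicator w (proj₁ c)) C)

module _ {w : Fin n} where

  indicator-∈ : ∀ {X} → w ∈ X → indicator w X ≡ 1
  indicator-∈ {X} w∈X with w ∈? X
  ... | yes _   = refl
  ... | no  w∉X = ⊥-elim (w∉X w∈X)

  indicator-∉ : ∀ {X} → w ∉ X → indicator w X ≡ 0
  indicator-∉ {X} w∉X with w ∈? X
  ... | yes w∈X = ⊥-elim (w∉X w∈X)
  ... | no  _   = refl

  indicator-∩ : ∀ {J X} → w ∈ J → indicator w (X ∩ J) ≡ indicator w X
  indicator-∩ {J} {X} w∈J with w ∈? X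
  ... | yes w∈X = indicator-∈ (x∈p∩q⁺ (w∈X , w∈J))
  ... | no  w∉X = indicator-∉ (λ w∈X∩J → w∉X (proj₁ (x∈p∩q⁻ X J w∈X∩J)))

  occurrences-++ : ∀ C D → occurrences w (C ++ D) ≡ occurrences w C + occurrences w D
  occurrences-++ C D = trans (cong sum (map-++ _ C D)) (sum-++ (map _ C) _)

  occurrences-↭ : ∀ {C D} → C ↭ D → occurrences w C ≡ occurrences w D
  occurrences-↭ C↭D = sum-↭ (↭.map⁺ _ C↭D)

  ∉⇒occurrences≡0 : ∀ {C} → All (λ c → w ∉ proj₁ c) C → occurrences w C ≡ 0
  ∉⇒occurrences≡0 []          = refl
  ∉⇒occurrences≡0 (w∉X ∷ w∉C) = cong₂ _+_ (indicator-∉ w∉X) (∉⇒occurrences≡0 w∉C)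

  occurrences≡0⇒∉ : ∀ C → occurrences w C ≡ 0 → All (λ c → w ∉ proj₁ c) C
  occurrences≡0⇒∉ []      _  = []
  occurrences≡0⇒∉ (c ∷ C) ≡0 =
    (λ w∈X → contradiction (trans (sym (indicator-∈ w∈X)) (m+n≡0⇒m≡0 _ ≡0)) λ ())
    ∷ occurrences≡0⇒∉ C (m+n≡0⇒n≡0 (indicator w (proj₁ c)) ≡0)

  occurrences≢0⇒∈ : ∀ C → ¬ occurrences w C ≡ 0 → Any (λ c → w ∈ proj₁ c) C
  occurrences≢0⇒∈ [] ≢0 = ⊥-elim (≢0 refl)
  occurrences≢0⇒∈ (c ∷ C) ≢0 with w ∈? proj₁ c
  ... | yes w∈X = Any.here w∈X
  ... | no  _   = Any.there (occurrences≢0⇒∈ C ≢0)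

  occurrences-restrict : ∀ {J} → w ∈ J → ∀ C → occurrences w (map (restrict J) C) ≡ occurrences w C
  occurrences-restrict w∈J []      = refl
  occurrences-restrict w∈J (c ∷ C) = cong₂ _+_ (indicator-∩ w∈J) (occurrences-restrict w∈J C)

record Admissible (I J : Subset n) (C : ConstraintSet n) : Set where
  field
    within       : All (λ c → proj₁ c ⊆ J) C
    satisfied    : Satisfies I C
    covered-once : ∀ {w} → w ∈ I → occurrences w C ≡ 1

initial-admissible : ∀ {S : Subset n} {k} → ∣ S ∣ ≡ k → Admissible S S ((S , k) ∷ [])
initial-admissible {S = S} ∣S∣≡k = record
  { within       = (λ w∈S → w∈S) ∷ []
  ; satisfied    = trans (cong ∣_∣ (∩-idem S)) ∣S∣≡k ∷ []
  ; covered-once = λ w∈S → cong (_+ 0) (indicator-∈ w∈S)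
  }

Admissible-resp-↭ : ∀ {I J : Subset n} {C D} → C ↭ D → Admissible I J C → Admissible I J D
Admissible-resp-↭ C↭D adm = record
  { within       = All-resp-↭ C↭D within
  ; satisfied    = All-resp-↭ C↭D satisfied
  ; covered-once = λ {w} w∈I → trans (sym (occurrences-↭ {w = w} C↭D)) (covered-once w∈I)
  }
  where open Admissible adm

select-↭ : ∀ {A : Set} {P : A → Set} {xs : List A} → Any P xs →
           Any (λ yr → P (proj₁ yr) × proj₁ yr ∷ proj₂ yr ↭ xs) (select xs)
select-↭ (Any.here px)                = Any.here (px , ↭-refl)
select-↭ {xs = x ∷ xs} (Any.there pxs) =
  Any.there (Any.map⁺ (Any.map (λ { {y , rest} (py , y∷rest↭xs) →
    py , ↭-trans (↭-swap y x ↭-refl) (↭-prep x y∷rest↭xs) }) (select-↭ pxs)))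

shrink : Subset n → Constraint n → ConstraintSet n
shrink J (X , b) = if b ≡ᵇ 1 then [] else ((X ∩ J , b ∸ 1) ∷ [])

shrink-within : ∀ J (c : Constraint n) → All (λ c′ → proj₁ c′ ⊆ J) (shrink J c)
shrink-within J (X , b) with b ≡ᵇ 1
... | true  = []
... | false = p∩q⊆q X J ∷ []

restrict-within : ∀ J (C : ConstraintSet n) → All (λ c → proj₁ c ⊆ J) (map (restrict J) C)
restrict-within J C = All.map⁺ (All.universal (λ { (X , _) {w} → p∩q⊆q X J {w} }) C)

module Slide (G : Graph n) {I I′ J J′ : Subset n} {u v : Fin n}
  (J-indep : Independent G J) (I⊆J : I ⊆ J) (I′⊆J′ : I′ ⊆ J′)
  (u∈I : u ∈ I) (uv : adj G u v ≡ true) (I′≡ : I′ ≡ (I - u) ∪ ⁅ v ⁆) where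

  v∉J : v ∉ J
  v∉J v∈J with () ← trans (sym uv) (J-indep u v (I⊆J u∈I) v∈J)

  v∈I′ : v ∈ I′
  v∈I′ = subst (v ∈_) (sym I′≡) (x∈p∪q⁺ (inj₂ (x∈⁅x⁆ v)))

  ∈I′⁺ : ∀ {w} → w ∈ I - u → w ∈ I′
  ∈I′⁺ w∈I-u = subst (_ ∈_) (sym I′≡) (x∈p∪q⁺ (inj₁ w∈I-u))

  ∈I′⁻ : ∀ {w} → w ∈ I′ → w ≡ v ⊎ w ∈ I - u
  ∈I′⁻ {w} w∈I′ with x∈p∪q⁻ (I - u) ⁅ v ⁆ (subst (w ∈_) I′≡ w∈I′)
  ... | inj₁ w∈I-u = inj₂ w∈I-u
  ... | inj₂ w∈⁅v⁆ = inj₁ (x∈⁅y⁆⇒x≡y v w∈⁅v⁆)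

  v∈Nbh∩J′ : ∀ {X} → X ⊆ J → u ∈ X → v ∈ Nbh G X ∩ J′
  v∈Nbh∩J′ X⊆J u∈X = x∈p∩q⁺ (∈Nbh⁺ G u∈X (λ v∈X → v∉J (X⊆J v∈X)) uv , I′⊆J′ v∈I′)

  I′∩restrict : ∀ {X} → X ⊆ J → I′ ∩ (X ∩ J′) ≡ (I ∩ X) - u
  I′∩restrict {X} X⊆J = ⊆-antisym forth back
    where
    forth : I′ ∩ (X ∩ J′) ⊆ (I ∩ X) - u
    forth w∈ with w∈I′ , w∈X∩J′ ← x∈p∩q⁻ I′ _ w∈ with w∈X , _ ← x∈p∩q⁻ X J′ w∈X∩J′ | ∈I′⁻ w∈I′
    ... | inj₁ refl  = ⊥-elim (v∉J (X⊆J w∈X))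
    ... | inj₂ w∈I-u =
      x∈p∧x≢y⇒x∈p-y (x∈p∩q⁺ (p─q⊆p I ⁅ u ⁆ w∈I-u , w∈X)) (x∈p-y⇒x≢y I w∈I-u)
    back : (I ∩ X) - u ⊆ I′ ∩ (X ∩ J′)
    back {w} w∈ with w∈I , w∈X ← x∈p∩q⁻ I X (p─q⊆p (I ∩ X) ⁅ u ⁆ w∈) =
      x∈p∩q⁺ (w∈I′ , x∈p∩q⁺ (w∈X , I′⊆J′ w∈I′))
      where
      w∈I′ : w ∈ I′
      w∈I′ = ∈I′⁺ (x∈p∧x≢y⇒x∈p-y w∈I (x∈p-y⇒x≢y (I ∩ X) w∈))

  I′∩Nbh : ∀ {X} → X ⊆ J → u ∈ X → I′ ∩ (Nbh G X ∩ J′) ≡ ⁅ v ⁆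
  I′∩Nbh {X} X⊆J u∈X = ⊆-antisym forth back
    where
    forth : I′ ∩ (Nbh G X ∩ J′) ⊆ ⁅ v ⁆
    forth w∈ with w∈I′ , w∈N∩J′ ← x∈p∩q⁻ I′ _ w∈ | ∈I′⁻ w∈I′
    ... | inj₁ refl  = x∈⁅x⁆ v
    ... | inj₂ w∈I-u = ⊥-elim (Nbh-disjoint G J-indep X⊆J (I⊆J (p─q⊆p I ⁅ u ⁆ w∈I-u))
                                 (proj₁ (x∈p∩q⁻ (Nbh G X) J′ w∈N∩J′)))
    back : ⁅ v ⁆ ⊆ I′ ∩ (Nbh G X ∩ J′)
    back w∈⁅v⁆ with refl ← x∈⁅y⁆⇒x≡y v w∈⁅v⁆ =
      x∈p∩q⁺ (v∈I′ , v∈Nbh∩J′ X⊆J u∈X)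

  ∣I′∩Nbh∣ : ∀ {X} → X ⊆ J → u ∈ X → ∣ I′ ∩ (Nbh G X ∩ J′) ∣ ≡ 1
  ∣I′∩Nbh∣ X⊆J u∈X = trans (cong ∣_∣ (I′∩Nbh X⊆J u∈X)) (∣⁅x⁆∣≡1 v)

  restrict-satisfied : ∀ {rest} → All (λ c → proj₁ c ⊆ J) rest → All (λ c → u ∉ proj₁ c) rest →
                       Satisfies I rest → Satisfies I′ (map (restrict J′) rest)
  restrict-satisfied [] [] [] = []
  restrict-satisfied {(X , _) ∷ _} (X⊆J ∷ ⊆J) (u∉X ∷ u∉) (sat ∷ sats) =
    trans (cong ∣_∣ (trans (I′∩restrict X⊆J) (x∉p⇒p-x≡p λ u∈I∩X → u∉X (proj₂ (x∈p∩q⁻ I X u∈I∩X))))) sat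
    ∷ restrict-satisfied ⊆J u∉ sats

  module Chosen {X b} (X⊆J : X ⊆ J) (u∈X : u ∈ X) (I∩X≡b : ∣ I ∩ X ∣ ≡ b) where

    ∣I′∩restrict∣ : ∣ I′ ∩ (X ∩ J′) ∣ ≡ b ∸ 1
    ∣I′∩restrict∣ = begin
      ∣ I′ ∩ (X ∩ J′) ∣  ≡⟨ cong ∣_∣ (I′∩restrict X⊆J) ⟩
      ∣ (I ∩ X) - u ∣    ≡⟨ cong (_∸ 1) (x∈p⇒∣p∣≡1+∣p-x∣ (x∈p∩q⁺ (u∈I , u∈X))) ⟨
      ∣ I ∩ X ∣ ∸ 1      ≡⟨ cong (_∸ 1) I∩X≡b ⟩
      b ∸ 1              ∎
      where open ≡-Reasoning

    shrink-satisfied : Satisfies I′ (shrink J′ (X , b))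
    shrink-satisfied with b ≡ᵇ 1
    ... | true  = []
    ... | false = ∣I′∩restrict∣ ∷ []

    shrink-occurrences : ∀ {w} → w ∈ I′ → occurrences w (shrink J′ (X , b)) ≡ indicator w X
    shrink-occurrences {w} w∈I′ with b ≡ᵇ 1 in b≡ᵇ1
    -- b = 1: u was the only token in X, so no token of I′ is left there.
    ... | true  = sym (indicator-∉ λ w∈X →
      ∣p∣≡0⇒x∉p (trans ∣I′∩restrict∣ (cong (_∸ 1) (≡ᵇ⇒≡ b 1 (subst T (sym b≡ᵇ1) tt))))
                (x∈p∩q⁺ (w∈I′ , x∈p∩q⁺ (w∈X , I′⊆J′ w∈I′))))
    ... | false = trans (+-identityʳ _) (indicator-∩ (I′⊆J′ w∈I′))

  step-admissible : ∀ {X b rest} → u ∈ X → Admissible I J ((X , b) ∷ rest) →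
                    Admissible I′ J′ (step G J′ (X , b) rest)
  step-admissible {X} {b} {rest} u∈X
    record { within = within@(X⊆J ∷ rest⊆J) ; satisfied = I∩X≡b ∷ rest-sat ; covered-once = covered-once } =
    record
      { within       = p∩q⊆q (Nbh G X) J′ ∷ All.++⁺ (shrink-within J′ (X , b)) (restrict-within J′ rest)
      ; satisfied = ∣I′∩Nbh∣ X⊆J u∈X ∷ All.++⁺ shrink-satisfied (restrict-satisfied rest⊆J u∉rest rest-sat)
      ; covered-once = covered-once′
      }
    where
    open Chosen X⊆J u∈X I∩X≡b
    N′ : Subset n
    N′ = Nbh G X ∩ J′

    u∉rest : All (λ c → u ∉ proj₁ c) rest
    u∉rest = occurrences≡0⇒∉ rest (suc-injective
      (trans (cong (_+ occurrences u rest) (sym (indicator-∈ u∈X))) (covered-once u∈I)))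

    new-or-old : ∀ {w} → w ∈ I′ → indicator w N′ + occurrences w ((X , b) ∷ rest) ≡ 1
    new-or-old {w} w∈I′ with ∈I′⁻ w∈I′
    ... | inj₁ refl  = cong₂ _+_ (indicator-∈ (v∈Nbh∩J′ X⊆J u∈X))
                                 (∉⇒occurrences≡0 (All.map (λ Y⊆J v∈Y → v∉J (Y⊆J v∈Y)) within))
    ... | inj₂ w∈I-u = cong₂ _+_ (indicator-∉ λ w∈N′ →
                                   Nbh-disjoint G J-indep X⊆J (I⊆J w∈I) (proj₁ (x∈p∩q⁻ (Nbh G X) J′ w∈N′)))
                                 (covered-once w∈I)
      where
      w∈I : w ∈ I
      w∈I = p─q⊆p I ⁅ u ⁆ w∈I-u

    covered-once′ : ∀ {w} → w ∈ I′ → occurrences w ((N′ , 1) ∷ shrink J′ (X , b) ++ map (restrict J′) rest) ≡ 1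
    covered-once′ {w} w∈I′ = begin
      indicator w N′ + occurrences w (shrink J′ (X , b) ++ map (restrict J′) rest)
        ≡⟨ cong (indicator w N′ +_) (occurrences-++ {w = w} (shrink J′ (X , b)) _) ⟩
      indicator w N′ + (occurrences w (shrink J′ (X , b)) + occurrences w (map (restrict J′) rest))
        ≡⟨ cong (indicator w N′ +_) (cong₂ _+_ (shrink-occurrences w∈I′) (occurrences-restrict (I′⊆J′ w∈I′) rest)) ⟩
      indicator w N′ + occurrences w ((X , b) ∷ rest)
        ≡⟨ new-or-old w∈I′ ⟩
      1 ∎
      where open ≡-Reasoning

  select-admissible : ∀ {C} → Admissible I J C →
                      Any (λ cr → Admissible I′ J′ (step G J′ (proj₁ cr) (proj₂ cr))) (select C)
  select-admissible {C} adm = Any.map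
    (λ { {(X , b) , rest} (u∈X , perm) → step-admissible u∈X (Admissible-resp-↭ (↭-sym perm) adm) })
    (select-↭ (occurrences≢0⇒∈ C λ ≡0 → contradiction (trans (sym (covered-once u∈I)) ≡0) λ ()))
    where open Admissible adm

module _ (G : Graph n) (S : Subset n) (k : ℕ) (J : ℕ → Subset n) where

  𝒞-suc-admissible : ∀ {i I I′} → Independent G (J i) → I ⊆ J i → I′ ⊆ J (suc i) →
    TokenSlide G I I′ → Any (Admissible I (J i)) (𝒞 G S k J i) →
    Any (Admissible I′ (J (suc i))) (𝒞 G S k J (suc i))
  𝒞-suc-admissible J-indep I⊆J I′⊆J′ (u , v , u∈I , _ , uv , I′≡ , _) =
    Any.concatMap⁺ _ ∘ Any.map λ adm → Any.map⁺
      (Slide.select-admissible G J-indep I⊆J I′⊆J′ u∈I uv I′≡ adm)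

  𝒞-admissible : (I : ℕ → Subset n) → I 0 ≡ S → J 0 ≡ S → ∣ S ∣ ≡ k → ∀ i →
    (∀ p → p < i → Independent G (J p)) → (∀ p → p < i → TokenSlide G (I p) (I (suc p))) →
    (∀ p → p ≤ i → I p ⊆ J p) → Any (Admissible (I i) (J i)) (𝒞 G S k J i)
  𝒞-admissible I I₀≡S J₀≡S ∣S∣≡k zero _ _ _ =
    Any.here (subst₂ (λ I₀ J₀ → Admissible I₀ J₀ _) (sym I₀≡S) (sym J₀≡S) (initial-admissible ∣S∣≡k))
  𝒞-admissible I I₀≡S J₀≡S ∣S∣≡k (suc i) indep slides I⊆J =
    𝒞-suc-admissible (indep i ≤-refl) (I⊆J i (n≤1+n i)) (I⊆J (suc i) ≤-refl) (slides i ≤-refl)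
      (𝒞-admissible I I₀≡S J₀≡S ∣S∣≡k i
        (λ p p<i → indep p (m<n⇒m<1+n p<i)) (λ p p<i → slides p (m<n⇒m<1+n p<i))
        (λ p p≤i → I⊆J p (m≤n⇒m≤1+n p≤i)))

lemma3p6 : ∀ {n : ℕ} (G : Graph n) (k ℓ : ℕ) → 1 ≤ k → 1 ≤ ℓ →
    (S : Subset n) → Independent G S → ∣ S ∣ ≡ k →
    (J : ℕ → Subset n) → J 0 ≡ S → (∀ p → p ≤ ℓ → Independent G (J p)) →
    ∀ (i : ℕ) → i ≤ ℓ →
    ∀ (Z : Subset n) → Independent G Z → Z ⊆ J i → ∣ Z ∣ ≡ k →
    (I : ℕ → Subset n) → I 0 ≡ S → I i ≡ Z →
    (∀ p → p < i → TokenSlide G (I p) (I (suc p))) →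
    (∀ p → p ≤ i → I p ⊆ J p) →
    Any (Satisfies Z) (𝒞 G S k J i)
lemma3p6 G k ℓ _ _ S _ ∣S∣≡k J J₀≡S indep i i≤ℓ Z _ _ _ I I₀≡S Iᵢ≡Z slides I⊆J =
  Any.map (λ adm → subst (λ W → Satisfies W _) Iᵢ≡Z (Admissible.satisfied adm))
    (𝒞-admissible G S k J I I₀≡S J₀≡S ∣S∣≡k i
      (λ p p<i → indep p (≤-trans (<⇒≤ p<i) i≤ℓ)) slides I⊆J)
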